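{- Let $p,q$ be distinct primes. Then, modulo $1-x^{pq}$, $$P_{pq}(x)=\frac{(1-x^{pq})(1-x)}{(1-x^p)(1-x^q)}\equiv \frac{1-x^{pq}}{1-x^q}\cdot\frac{1-x^{p\langle p^{ -1}\rangle_q}}{1-x^p}+\frac{1-x^{pq}}{1-x^p}\cdot\frac{x^{pq}-x^{q\langle q^{ -1}\rangle_p}}{1-x^q},$$ where the right-hand side is a polynomial.
   Context: For a rational number $c=a/b$ with $b$ coprime to $m$, $\langle c\rangle_m$ denotes the smallest nonnegative integer $k$ with $kb\equiv a\pmod m$. -}

module Defs where

open import Data.Nat as ℕ using (ℕ; zero; suc; _<_)
open import Data.Integer as ℤ using (ℤ; +_; 0ℤ; 1ℤ)
open import Data.Integer.Divisibility using (_∣_)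
open import Data.List using (List; []; _∷_; map; replicate; _++_)
open import Data.Product using (Σ; _×_)
open import Relation.Binary.PropositionalEquality using (_≡_)
open import Relation.Nullary using (¬_)

-- ⟨a/b⟩_m = k : k is the smallest natural number with k*b ≡ a (mod m)
Bracket : (m a b k : ℕ) → Set
Bracket m a b k =
  ((+ m) ∣ ((+ k) ℤ.* (+ b) ℤ.- (+ a))) ×
  (∀ j → j < k → ¬ ((+ m) ∣ ((+ j) ℤ.* (+ b) ℤ.- (+ a))))

-- Polynomials over ℤ as coefficient lists (index i = coefficient of x^i)
Poly : Set
Poly = List ℤ

coeff : Poly → ℕ → ℤ
coeff []       _       = 0ℤ
coeff (a ∷ _)  zero    = a
coeff (_ ∷ as) (suc n) = coeff as n

infixl 6 _+ₚ_ _-ₚ_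
infixl 7 _*ₚ_
infix 4 _≈ₚ_

_+ₚ_ : Poly → Poly → Poly
[]       +ₚ q        = q
(a ∷ p)  +ₚ []       = a ∷ p
(a ∷ p)  +ₚ (b ∷ q)  = (a ℤ.+ b) ∷ (p +ₚ q)

-ₚ_ : Poly → Poly
-ₚ p = map ℤ.-_ p

_-ₚ_ : Poly → Poly → Poly
p -ₚ q = p +ₚ (-ₚ q)

_*ₚ_ : Poly → Poly → Poly
[]      *ₚ q = []
(a ∷ p) *ₚ q = map (a ℤ.*_) q +ₚ (0ℤ ∷ (p *ₚ q))

oneₚ : Poly
oneₚ = 1ℤ ∷ []

X^ : ℕ → Poly
X^ n = replicate n 0ℤ ++ (1ℤ ∷ [])

-- equality of polynomials (coefficientwise, ignoring trailing zeros)
_≈ₚ_ : Poly → Poly → Set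
p ≈ₚ q = ∀ n → coeff p n ≡ coeff q n

IsQuot : (Q N D : Poly) → Set
IsQuot Q N D = Q *ₚ D ≈ₚ N

CongMod : (A B M : Poly) → Set
CongMod A B M = Σ Poly (λ H → A -ₚ B ≈ₚ H *ₚ M)

{-# OPTIONS --safe #-}
module Submission where

open import Defs
import Algebra.Properties.CommutativeSemigroup
open import Algebra.Bundles using (CommutativeRing; CommutativeSemigroup)
open import Data.Integer as ℤ using (ℤ; +_; 0ℤ; 1ℤ; ∣_∣)
import Data.Integer.Properties as ℤ
open import Data.Integer.Divisibility.Signed
  using (∣ᵤ⇒∣; ∣⇒∣ᵤ; ∣m+n∣n⇒∣m; ∣m⇒∣m*n; ∣-refl) renaming (_∣_ to _∣ℤ_)
import Data.Integer.Tactic.RingSolver as ℤ-Solver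
open import Data.List using ([]; _∷_; map)
open import Data.Maybe as Maybe using (Maybe; just; nothing)
open import Data.Nat
  using (ℕ; zero; suc; _+_; _*_; _∸_; _<_; _≤_; _≤?_; NonZero; nonTrivial⇒≢1; nonTrivial⇒n>1; >-nonZero⁻¹)
open import Data.Nat.Coprimality using (Coprime; coprime-divisor)
open import Data.Nat.Divisibility using (_∣_; divides; ∣1⇒≡1)
open import Data.Nat.Primality using (Prime; prime⇒irreducible; prime⇒nonTrivial; prime⇒nonZero)
open import Data.Nat.Properties
open import Data.Product using (Σ; _×_; ∃-syntax; _,_; map₂)
open import Data.Sum using (inj₁; inj₂)
open import Function using (_∘_)
open import Level using (0ℓ)
open import Relation.Binary.PropositionalEquality
import Relation.Binary.Reasoning.Setoid
open import Relation.Nullary using (yes; no; contradiction)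
open import Tactic.RingSolver using (solve-∀)
open import Tactic.RingSolver.Core.AlmostCommutativeRing using (AlmostCommutativeRing; fromCommutativeRing)

-- Write p a = 1 + q s and q b = 1 + p t.  Then p (a + t) = q (s + b), so q ∣ a + t, and
-- 0 < a + t < 2 q forces a + t = q, that is, p q = 1 + q s + p t.  Hence with x = X,
-- y = X^(q s) and z = X^(p t) we have X^(p a) = x y, X^(q b) = x z and X^(p q) = x y z, and the
-- right-hand side times (1 - X^p)(1 - X^q) is
--   (1 - X^(pq)) ((1 - x y) + (x y z - x z)) = (1 - X^(pq)) ((1 - x) + x (1 - y) (1 - z)).
-- As 1 - X^q divides 1 - y and 1 - X^p divides 1 - z, the right-hand side is P_pq plus a multiple
-- of 1 - X^(pq).  All quotients involved are geometric sums, and they are unique because every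
-- divisor has constant term 1.

bracket-< : ∀ {m c k} .{{_ : NonZero m}} → Bracket m 1 c k → k < m
bracket-< {m} {c} {k} (m∣kc-1 , minimal) with m ≤? k
... | no m≰k = ≰⇒> m≰k
... | yes m≤k with j , refl ← m≤n⇒∃[o]m+o≡n m≤k =
  contradiction (∣⇒∣ᵤ m∣jc-1) (minimal j (m<n+m j (>-nonZero⁻¹ m)))
  where
  unfold : + (m + j) ℤ.* + c ℤ.- + 1 ≡ (+ j ℤ.* + c ℤ.- + 1) ℤ.+ + m ℤ.* + c
  unfold = trans (cong (λ i → i ℤ.* + c ℤ.- + 1) (ℤ.pos-+ m j)) (shift (+ m) (+ j) (+ c))
    where
    shift : ∀ m j c → (m ℤ.+ j) ℤ.* c ℤ.- + 1 ≡ (j ℤ.* c ℤ.- + 1) ℤ.+ m ℤ.* c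
    shift = ℤ-Solver.solve-∀
  m∣jc-1 : + m ∣ℤ + j ℤ.* + c ℤ.- + 1
  m∣jc-1 = ∣m+n∣n⇒∣m (subst (+ m ∣ℤ_) unfold (∣ᵤ⇒∣ m∣kc-1)) (∣m⇒∣m*n (+ c) ∣-refl)

bracket-≡ : ∀ {m c k} → 1 < m → Bracket m 1 c k → ∃[ s ] c * k ≡ suc (m * s)
bracket-≡ {m} {c} {k} 1<m (m∣kc-1 , _) = map₂ (trans (*-comm c k))
  (predecessor-multiple (k * c) (subst (λ i → m ∣ ∣ i ℤ.- + 1 ∣) (sym (ℤ.pos-* k c)) m∣kc-1))
  where
  predecessor-multiple : ∀ n → m ∣ ∣ + n ℤ.- + 1 ∣ → ∃[ s ] n ≡ suc (m * s)
  predecessor-multiple zero    m∣1              = contradiction (∣1⇒≡1 m∣1) (>⇒≢ 1<m)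
  predecessor-multiple (suc n) (divides s n≡sm) = s , cong suc (trans n≡sm (*-comm s m))

distinct-primes-coprime : ∀ {p q} → Prime p → Prime q → p ≢ q → Coprime p q
distinct-primes-coprime {p} p-prime q-prime p≢q {d} (d∣p , d∣q) with prime⇒irreducible p-prime d∣p
... | inj₁ d≡1 = d≡1
... | inj₂ refl with prime⇒irreducible q-prime d∣q
...   | inj₁ p≡1 = contradiction p≡1 (nonTrivial⇒≢1 {{prime⇒nonTrivial p-prime}})
...   | inj₂ p≡q = contradiction p≡q p≢q

nonzero-multiple-below-double : ∀ {m n} → m ∣ n → 0 < n → n < m + m → n ≡ m
nonzero-multiple-below-double (divides zero    refl) ()
nonzero-multiple-below-double {m} (divides (suc zero) refl) _ _ = +-identityʳ m
nonzero-multiple-below-double {m} (divides (suc (suc r)) refl) _ n<2m =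
  contradiction n<2m (≤⇒≯ (subst (m + m ≤_) (+-assoc m m (r * m)) (m≤m+n (m + m) (r * m))))

cofactor-sum : ∀ {p q a b s t} → Prime p → Prime q → p ≢ q → a < q → b < p →
  p * a ≡ suc (q * s) → q * b ≡ suc (p * t) → a + t ≡ q
cofactor-sum {p} {q} {a} {b} {s} {t} p-prime q-prime p≢q a<q b<p pa≡1+qs qb≡1+pt =
  nonzero-multiple-below-double
    (coprime-divisor (distinct-primes-coprime q-prime p-prime (p≢q ∘ sym)) (divides (s + b) p[a+t]≡[s+b]q))
    (≤-trans (n≢0⇒n>0 a≢0) (m≤m+n a t)) (+-mono-< a<q t<q)
  where
  instance
    q≢0 = prime⇒nonZero q-prime
  a≢0 : a ≢ 0
  a≢0 refl = 0≢1+n (trans (sym (*-zeroʳ p)) pa≡1+qs)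
  t<q : t < q
  t<q = *-cancelˡ-< p t q (begin-strict
    p * t       <⟨ n<1+n (p * t) ⟩
    suc (p * t) ≡⟨ qb≡1+pt ⟨
    q * b       <⟨ *-monoʳ-< q b<p ⟩
    q * p       ≡⟨ *-comm q p ⟩
    p * q       ∎)
    where open ≤-Reasoning
  p[a+t]≡[s+b]q : p * (a + t) ≡ (s + b) * q
  p[a+t]≡[s+b]q = begin
    p * (a + t)         ≡⟨ *-distribˡ-+ p a t ⟩
    p * a + p * t       ≡⟨ cong (_+ p * t) pa≡1+qs ⟩
    suc (q * s) + p * t ≡⟨ +-suc (q * s) (p * t) ⟨
    q * s + suc (p * t) ≡⟨ cong (_+_ (q * s)) qb≡1+pt ⟨
    q * s + q * b       ≡⟨ *-distribˡ-+ q s b ⟨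
    q * (s + b)         ≡⟨ *-comm q (s + b) ⟩
    (s + b) * q         ∎
    where open ≡-Reasoning

record InverseExponents (p q a b : ℕ) : Set where
  field
    s t        : ℕ
    pa≡1+qs    : p * a ≡ suc (q * s)
    qb≡1+pt    : q * b ≡ suc (p * t)
    pq≡1+qs+pt : p * q ≡ suc (q * s + p * t)
    b≤p        : b ≤ p

inverse-exponents : ∀ {p q a b} → Prime p → Prime q → p ≢ q →
  Bracket q 1 p a → Bracket p 1 q b → InverseExponents p q a b
inverse-exponents {p} {q} {a} {b} p-prime q-prime p≢q a-inv b-inv
  with s , pa≡1+qs ← bracket-≡ (nonTrivial⇒n>1 q {{prime⇒nonTrivial q-prime}}) a-inv
     | t , qb≡1+pt ← bracket-≡ (nonTrivial⇒n>1 p {{prime⇒nonTrivial p-prime}}) b-inv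
  = record
    { s = s ; t = t ; pa≡1+qs = pa≡1+qs ; qb≡1+pt = qb≡1+pt
    ; pq≡1+qs+pt = pq≡1+qs+pt ; b≤p = <⇒≤ b<p }
  where
  instance
    p≢0 = prime⇒nonZero p-prime
    q≢0 = prime⇒nonZero q-prime
  b<p : b < p
  b<p = bracket-< b-inv
  pq≡1+qs+pt : p * q ≡ suc (q * s + p * t)
  pq≡1+qs+pt = begin
    p * q               ≡⟨ cong (p *_) (cofactor-sum p-prime q-prime p≢q (bracket-< a-inv) b<p pa≡1+qs qb≡1+pt) ⟨
    p * (a + t)         ≡⟨ *-distribˡ-+ p a t ⟩
    p * a + p * t       ≡⟨ cong (_+ p * t) pa≡1+qs ⟩
    suc (q * s + p * t) ∎
    where open ≡-Reasoning

-- A record rather than ≈ₚ itself, which unfolds to a Π-type and then leaves p and q uninferable.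
infix 4 _≋_
record _≋_ (p q : Poly) : Set where
  constructor mk≋
  field coeff-≡ : p ≈ₚ q
open _≋_ public

≋-refl : ∀ {p} → p ≋ p
≋-refl = mk≋ λ _ → refl

≋-sym : ∀ {p q} → p ≋ q → q ≋ p
≋-sym p≋q = mk≋ λ n → sym (coeff-≡ p≋q n)

≋-trans : ∀ {p q r} → p ≋ q → q ≋ r → p ≋ r
≋-trans p≋q q≋r = mk≋ λ n → trans (coeff-≡ p≋q n) (coeff-≡ q≋r n)

≋-reflexive : ∀ {p q} → p ≡ q → p ≋ q
≋-reflexive refl = ≋-refl

infixr 8 _·ₚ_
_·ₚ_ : ℤ → Poly → Poly
a ·ₚ p = map (a ℤ.*_) p

coeff-+ₚ : ∀ p q n → coeff (p +ₚ q) n ≡ coeff p n ℤ.+ coeff q n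
coeff-+ₚ []      q       n       = sym (ℤ.+-identityˡ _)
coeff-+ₚ (a ∷ p) []      n       = sym (ℤ.+-identityʳ _)
coeff-+ₚ (a ∷ p) (b ∷ q) zero    = refl
coeff-+ₚ (a ∷ p) (b ∷ q) (suc n) = coeff-+ₚ p q n

coeff--ₚ : ∀ p n → coeff (-ₚ p) n ≡ ℤ.- coeff p n
coeff--ₚ []      n       = refl
coeff--ₚ (a ∷ p) zero    = refl
coeff--ₚ (a ∷ p) (suc n) = coeff--ₚ p n

coeff-·ₚ : ∀ a p n → coeff (a ·ₚ p) n ≡ a ℤ.* coeff p n
coeff-·ₚ a []      n       = sym (ℤ.*-zeroʳ a)
coeff-·ₚ a (b ∷ p) zero    = refl
coeff-·ₚ a (b ∷ p) (suc n) = coeff-·ₚ a p n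

∷-cong : ∀ {a b p q} → a ≡ b → p ≋ q → a ∷ p ≋ b ∷ q
∷-cong a≡b p≋q = mk≋ λ { zero → a≡b ; (suc n) → coeff-≡ p≋q n }

[]≋0∷[] : [] ≋ 0ℤ ∷ []
[]≋0∷[] = mk≋ λ { zero → refl ; (suc n) → refl }

+ₚ-cong : ∀ {p p′ q q′} → p ≋ p′ → q ≋ q′ → p +ₚ q ≋ p′ +ₚ q′
+ₚ-cong {p} {p′} {q} {q′} p≋p′ q≋q′ = mk≋ coeffwise
  where
  coeffwise : p +ₚ q ≈ₚ p′ +ₚ q′
  coeffwise n rewrite coeff-+ₚ p q n | coeff-+ₚ p′ q′ n | coeff-≡ p≋p′ n | coeff-≡ q≋q′ n = refl

-ₚ-cong : ∀ {p p′} → p ≋ p′ → -ₚ p ≋ -ₚ p′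
-ₚ-cong {p} {p′} p≋p′ = mk≋ coeffwise
  where
  coeffwise : -ₚ p ≈ₚ -ₚ p′
  coeffwise n rewrite coeff--ₚ p n | coeff--ₚ p′ n | coeff-≡ p≋p′ n = refl

+ₚ-assoc : ∀ p q r → (p +ₚ q) +ₚ r ≋ p +ₚ (q +ₚ r)
+ₚ-assoc p q r = mk≋ coeffwise
  where
  coeffwise : (p +ₚ q) +ₚ r ≈ₚ p +ₚ (q +ₚ r)
  coeffwise n rewrite coeff-+ₚ (p +ₚ q) r n | coeff-+ₚ p q n | coeff-+ₚ p (q +ₚ r) n | coeff-+ₚ q r n
    = ℤ.+-assoc (coeff p n) (coeff q n) (coeff r n)

+ₚ-comm : ∀ p q → p +ₚ q ≋ q +ₚ p
+ₚ-comm p q = mk≋ coeffwise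
  where
  coeffwise : p +ₚ q ≈ₚ q +ₚ p
  coeffwise n rewrite coeff-+ₚ p q n | coeff-+ₚ q p n = ℤ.+-comm (coeff p n) (coeff q n)

+ₚ-identityʳ : ∀ p → p +ₚ [] ≋ p
+ₚ-identityʳ p = mk≋ λ n → trans (coeff-+ₚ p [] n) (ℤ.+-identityʳ (coeff p n))

-ₚ-inverseʳ : ∀ p → p +ₚ (-ₚ p) ≋ []
-ₚ-inverseʳ p = mk≋ coeffwise
  where
  coeffwise : p +ₚ (-ₚ p) ≈ₚ []
  coeffwise n rewrite coeff-+ₚ p (-ₚ p) n | coeff--ₚ p n = ℤ.+-inverseʳ (coeff p n)

+ₚ-commutativeSemigroup : CommutativeSemigroup 0ℓ 0ℓ
+ₚ-commutativeSemigroup = record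
  { _≈_ = _≋_
  ; _∙_ = _+ₚ_
  ; isCommutativeSemigroup = record
    { isSemigroup = record
      { isMagma = record
        { isEquivalence = record { refl = ≋-refl ; sym = ≋-sym ; trans = ≋-trans }
        ; ∙-cong = +ₚ-cong }
      ; assoc = +ₚ-assoc }
    ; comm = +ₚ-comm }
  }

open Algebra.Properties.CommutativeSemigroup +ₚ-commutativeSemigroup
  using (interchange; x∙yz≈y∙xz)

·ₚ-congʳ : ∀ a {p p′} → p ≋ p′ → a ·ₚ p ≋ a ·ₚ p′
·ₚ-congʳ a {p} {p′} p≋p′ = mk≋ coeffwise
  where
  coeffwise : a ·ₚ p ≈ₚ a ·ₚ p′
  coeffwise n rewrite coeff-·ₚ a p n | coeff-·ₚ a p′ n | coeff-≡ p≋p′ n = refl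

·ₚ-distribʳ : ∀ a b p → (a ℤ.+ b) ·ₚ p ≋ a ·ₚ p +ₚ b ·ₚ p
·ₚ-distribʳ a b p = mk≋ coeffwise
  where
  coeffwise : (a ℤ.+ b) ·ₚ p ≈ₚ a ·ₚ p +ₚ b ·ₚ p
  coeffwise n rewrite coeff-+ₚ (a ·ₚ p) (b ·ₚ p) n | coeff-·ₚ (a ℤ.+ b) p n | coeff-·ₚ a p n | coeff-·ₚ b p n
    = ℤ.*-distribʳ-+ (coeff p n) a b

·ₚ-distribˡ : ∀ a p q → a ·ₚ (p +ₚ q) ≋ a ·ₚ p +ₚ a ·ₚ q
·ₚ-distribˡ a p q = mk≋ coeffwise
  where
  coeffwise : a ·ₚ (p +ₚ q) ≈ₚ a ·ₚ p +ₚ a ·ₚ q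
  coeffwise n rewrite coeff-+ₚ (a ·ₚ p) (a ·ₚ q) n | coeff-·ₚ a (p +ₚ q) n | coeff-+ₚ p q n | coeff-·ₚ a p n | coeff-·ₚ a q n
    = ℤ.*-distribˡ-+ a (coeff p n) (coeff q n)

·ₚ-assoc : ∀ a b p → (a ℤ.* b) ·ₚ p ≋ a ·ₚ (b ·ₚ p)
·ₚ-assoc a b p = mk≋ coeffwise
  where
  coeffwise : (a ℤ.* b) ·ₚ p ≈ₚ a ·ₚ (b ·ₚ p)
  coeffwise n rewrite coeff-·ₚ (a ℤ.* b) p n | coeff-·ₚ a (b ·ₚ p) n | coeff-·ₚ b p n
    = ℤ.*-assoc a b (coeff p n)

·ₚ-zeroˡ : ∀ p → 0ℤ ·ₚ p ≋ []
·ₚ-zeroˡ p = mk≋ λ n → coeff-·ₚ 0ℤ p n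

·ₚ-identityˡ : ∀ p → 1ℤ ·ₚ p ≋ p
·ₚ-identityˡ p = mk≋ λ n → trans (coeff-·ₚ 1ℤ p n) (ℤ.*-identityˡ (coeff p n))

*ₚ-congʳ : ∀ p {q q′} → q ≋ q′ → p *ₚ q ≋ p *ₚ q′
*ₚ-congʳ []      q≋q′ = ≋-refl
*ₚ-congʳ (a ∷ p) q≋q′ = +ₚ-cong (·ₚ-congʳ a q≋q′) (∷-cong refl (*ₚ-congʳ p q≋q′))

*ₚ-zeroʳ : ∀ p → p *ₚ [] ≋ []
*ₚ-zeroʳ []      = ≋-refl
*ₚ-zeroʳ (a ∷ p) = ≋-trans (∷-cong refl (*ₚ-zeroʳ p)) (≋-sym []≋0∷[])

*ₚ-∷ʳ : ∀ p b q → p *ₚ (b ∷ q) ≋ b ·ₚ p +ₚ (0ℤ ∷ p *ₚ q)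
*ₚ-∷ʳ []      b q = []≋0∷[]
*ₚ-∷ʳ (a ∷ p) b q = ∷-cong (cong (ℤ._+ 0ℤ) (ℤ.*-comm a b))
  (≋-trans (+ₚ-cong ≋-refl (*ₚ-∷ʳ p b q)) (x∙yz≈y∙xz (a ·ₚ q) (b ·ₚ p) (0ℤ ∷ p *ₚ q)))

*ₚ-comm : ∀ p q → p *ₚ q ≋ q *ₚ p
*ₚ-comm []      q = ≋-sym (*ₚ-zeroʳ q)
*ₚ-comm (a ∷ p) q = ≋-sym (≋-trans (*ₚ-∷ʳ q a p) (+ₚ-cong ≋-refl (∷-cong refl (*ₚ-comm q p))))

*ₚ-congˡ : ∀ {p p′} q → p ≋ p′ → p *ₚ q ≋ p′ *ₚ q
*ₚ-congˡ {p} {p′} q p≋p′ = ≋-trans (*ₚ-comm p q) (≋-trans (*ₚ-congʳ q p≋p′) (*ₚ-comm q p′))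

*ₚ-cong : ∀ {p p′ q q′} → p ≋ p′ → q ≋ q′ → p *ₚ q ≋ p′ *ₚ q′
*ₚ-cong {p′ = p′} {q = q} p≋p′ q≋q′ = ≋-trans (*ₚ-congˡ q p≋p′) (*ₚ-congʳ p′ q≋q′)

*ₚ-distribʳ : ∀ q p p′ → (p +ₚ p′) *ₚ q ≋ p *ₚ q +ₚ p′ *ₚ q
*ₚ-distribʳ q []      p′       = ≋-refl
*ₚ-distribʳ q (a ∷ p) []       = ≋-sym (+ₚ-identityʳ ((a ∷ p) *ₚ q))
*ₚ-distribʳ q (a ∷ p) (b ∷ p′) = ≋-trans
  (+ₚ-cong (·ₚ-distribʳ a b q) (∷-cong refl (*ₚ-distribʳ q p p′)))
  (interchange (a ·ₚ q) (b ·ₚ q) (0ℤ ∷ p *ₚ q) (0ℤ ∷ p′ *ₚ q))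

*ₚ-distribˡ : ∀ p q q′ → p *ₚ (q +ₚ q′) ≋ p *ₚ q +ₚ p *ₚ q′
*ₚ-distribˡ p q q′ = ≋-trans (*ₚ-comm p (q +ₚ q′))
  (≋-trans (*ₚ-distribʳ p q q′) (+ₚ-cong (*ₚ-comm q p) (*ₚ-comm q′ p)))

·ₚ-*ₚ-assoc : ∀ a p q → (a ·ₚ p) *ₚ q ≋ a ·ₚ (p *ₚ q)
·ₚ-*ₚ-assoc a []      q = ≋-refl
·ₚ-*ₚ-assoc a (b ∷ p) q = ≋-trans
  (+ₚ-cong (·ₚ-assoc a b q) (∷-cong (sym (ℤ.*-zeroʳ a)) (·ₚ-*ₚ-assoc a p q)))
  (≋-sym (·ₚ-distribˡ a (b ·ₚ q) (0ℤ ∷ p *ₚ q)))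

0∷-*ₚ : ∀ p q → (0ℤ ∷ p) *ₚ q ≋ 0ℤ ∷ p *ₚ q
0∷-*ₚ p q = +ₚ-cong (·ₚ-zeroˡ q) ≋-refl

*ₚ-assoc : ∀ p q r → (p *ₚ q) *ₚ r ≋ p *ₚ (q *ₚ r)
*ₚ-assoc []      q r = ≋-refl
*ₚ-assoc (a ∷ p) q r = ≋-trans (*ₚ-distribʳ r (a ·ₚ q) (0ℤ ∷ p *ₚ q))
  (+ₚ-cong (·ₚ-*ₚ-assoc a q r) (≋-trans (0∷-*ₚ (p *ₚ q) r) (∷-cong refl (*ₚ-assoc p q r))))

*ₚ-identityˡ : ∀ p → oneₚ *ₚ p ≋ p
*ₚ-identityˡ p = ≋-trans (+ₚ-cong (·ₚ-identityˡ p) (≋-sym []≋0∷[])) (+ₚ-identityʳ p)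

ℤ[X] : CommutativeRing 0ℓ 0ℓ
ℤ[X] = record
  { Carrier = Poly ; _≈_ = _≋_ ; _+_ = _+ₚ_ ; _*_ = _*ₚ_ ; -_ = -ₚ_ ; 0# = [] ; 1# = oneₚ
  ; isCommutativeRing = record
    { isRing = record
      { +-isAbelianGroup = record
        { isGroup = record
          { isMonoid = record
            { isSemigroup = CommutativeSemigroup.isSemigroup +ₚ-commutativeSemigroup
            ; identity = (λ p → ≋-refl) , +ₚ-identityʳ }
          ; inverse = (λ p → ≋-trans (+ₚ-comm (-ₚ p) p) (-ₚ-inverseʳ p)) , -ₚ-inverseʳ
          ; ⁻¹-cong = -ₚ-cong }
        ; comm = +ₚ-comm }
      ; *-cong = *ₚ-cong
      ; *-assoc = *ₚ-assoc
      ; *-identity = *ₚ-identityˡ , (λ p → ≋-trans (*ₚ-comm p oneₚ) (*ₚ-identityˡ p))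
      ; distrib = *ₚ-distribˡ , *ₚ-distribʳ }
    ; *-comm = *ₚ-comm }
  }

module ≋-Reasoning = Relation.Binary.Reasoning.Setoid (CommutativeRing.setoid ℤ[X])

-- Without a zero test the solver cannot cancel terms such as y - y.
[]≋? : ∀ p → Maybe ([] ≋ p)
[]≋? []        = just ≋-refl
[]≋? (+ 0 ∷ p) = Maybe.map (λ []≋p → ≋-trans []≋0∷[] (∷-cong refl []≋p)) ([]≋? p)
[]≋? (_ ∷ _)   = nothing

ℤ[X]-solver-ring : AlmostCommutativeRing 0ℓ 0ℓ
ℤ[X]-solver-ring = fromCommutativeRing ℤ[X] []≋?

X^-+ : ∀ m n → X^ m *ₚ X^ n ≋ X^ (m + n)
X^-+ zero    n = *ₚ-identityˡ (X^ n)
X^-+ (suc m) n = ≋-trans (0∷-*ₚ (X^ m) (X^ n)) (∷-cong refl (X^-+ m n))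

geometric : ℕ → ℕ → Poly
geometric m zero    = []
geometric m (suc k) = oneₚ +ₚ X^ m *ₚ geometric m k

geometric-quotient : ∀ m k → geometric m k *ₚ (oneₚ -ₚ X^ m) ≋ oneₚ -ₚ X^ (m * k)
geometric-quotient m zero rewrite *-zeroʳ m = mk≋ λ { zero → refl ; (suc n) → refl }
geometric-quotient m (suc k) = begin
  (oneₚ +ₚ X^ m *ₚ geometric m k) *ₚ (oneₚ -ₚ X^ m)
    ≈⟨ telescope (X^ m) (geometric m k) ⟩
  (oneₚ -ₚ X^ m) +ₚ X^ m *ₚ (geometric m k *ₚ (oneₚ -ₚ X^ m))
    ≈⟨ +ₚ-cong ≋-refl (*ₚ-congʳ (X^ m) (geometric-quotient m k)) ⟩
  (oneₚ -ₚ X^ m) +ₚ X^ m *ₚ (oneₚ -ₚ X^ (m * k))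
    ≈⟨ collapse (X^ m) (X^ (m * k)) ⟩
  oneₚ -ₚ X^ m *ₚ X^ (m * k)
    ≈⟨ +ₚ-cong ≋-refl (-ₚ-cong (X^-+ m (m * k))) ⟩
  oneₚ -ₚ X^ (m + m * k)
    ≈⟨ ≋-reflexive (cong (λ e → oneₚ -ₚ X^ e) (*-suc m k)) ⟨
  oneₚ -ₚ X^ (m * suc k) ∎
  where
  open ≋-Reasoning
  telescope : ∀ y g → (oneₚ +ₚ y *ₚ g) *ₚ (oneₚ -ₚ y) ≋ (oneₚ -ₚ y) +ₚ y *ₚ (g *ₚ (oneₚ -ₚ y))
  telescope = solve-∀ ℤ[X]-solver-ring
  collapse : ∀ y w → (oneₚ -ₚ y) +ₚ y *ₚ (oneₚ -ₚ w) ≋ oneₚ -ₚ y *ₚ w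
  collapse = solve-∀ ℤ[X]-solver-ring

shifted-geometric-quotient : ∀ n m k →
  (-ₚ (X^ n *ₚ geometric m k)) *ₚ (oneₚ -ₚ X^ m) ≋ X^ (n + m * k) -ₚ X^ n
shifted-geometric-quotient n m k = begin
  (-ₚ (X^ n *ₚ geometric m k)) *ₚ (oneₚ -ₚ X^ m) ≈⟨ regroup (X^ n) (geometric m k) (oneₚ -ₚ X^ m) ⟩
  -ₚ (X^ n *ₚ (geometric m k *ₚ (oneₚ -ₚ X^ m))) ≈⟨ -ₚ-cong (*ₚ-congʳ (X^ n) (geometric-quotient m k)) ⟩
  -ₚ (X^ n *ₚ (oneₚ -ₚ X^ (m * k)))              ≈⟨ expand (X^ n) (X^ (m * k)) ⟩
  X^ n *ₚ X^ (m * k) -ₚ X^ n                     ≈⟨ +ₚ-cong (X^-+ n (m * k)) ≋-refl ⟩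
  X^ (n + m * k) -ₚ X^ n                         ∎
  where
  open ≋-Reasoning
  regroup : ∀ y g d → (-ₚ (y *ₚ g)) *ₚ d ≋ -ₚ (y *ₚ (g *ₚ d))
  regroup = solve-∀ ℤ[X]-solver-ring
  expand : ∀ y w → -ₚ (y *ₚ (oneₚ -ₚ w)) ≋ y *ₚ w -ₚ y
  expand = solve-∀ ℤ[X]-solver-ring

coeff-*ₚ-0 : ∀ p q → coeff (p *ₚ q) 0 ≡ coeff p 0 ℤ.* coeff q 0
coeff-*ₚ-0 []      q = refl
coeff-*ₚ-0 (a ∷ p) q = trans (coeff-+ₚ (a ·ₚ q) (0ℤ ∷ p *ₚ q) 0)
  (trans (ℤ.+-identityʳ _) (coeff-·ₚ a q 0))

coeff-1-X^-0 : ∀ m .{{_ : NonZero m}} → coeff (oneₚ -ₚ X^ m) 0 ≡ 1ℤ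
coeff-1-X^-0 (suc m) = refl

*ₚ-cancelʳ-[] : ∀ {d} p → coeff d 0 ≢ 0ℤ → p *ₚ d ≋ [] → p ≋ []
*ₚ-cancelʳ-[]     []      d₀≢0 pd≋[] = ≋-refl
*ₚ-cancelʳ-[] {d} (a ∷ p) d₀≢0 ad+0∷pd≋[] =
  ≋-trans (∷-cong a≡0 (*ₚ-cancelʳ-[] p d₀≢0 pd≋[])) (≋-sym []≋0∷[])
  where
  a≡0 : a ≡ 0ℤ
  a≡0 with ℤ.i*j≡0⇒i≡0∨j≡0 a (trans (sym (coeff-*ₚ-0 (a ∷ p) d)) (coeff-≡ ad+0∷pd≋[] 0))
  ... | inj₁ a≡0  = a≡0
  ... | inj₂ d₀≡0 = contradiction d₀≡0 d₀≢0
  ad≋[] : a ·ₚ d ≋ []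
  ad≋[] rewrite a≡0 = ·ₚ-zeroˡ d
  pd≋[] : p *ₚ d ≋ []
  pd≋[] = mk≋ λ n → coeff-≡ (≋-trans (+ₚ-cong (≋-sym ad≋[]) ≋-refl) ad+0∷pd≋[]) (suc n)

quotient-unique : ∀ q q′ {n d} → coeff d 0 ≢ 0ℤ → IsQuot q n d → q′ *ₚ d ≋ n → q ≋ q′
quotient-unique q q′ {n} {d} d₀≢0 qd≈n q′d≋n = begin
  q               ≈⟨ split q q′ ⟩
  (q -ₚ q′) +ₚ q′ ≈⟨ +ₚ-cong (*ₚ-cancelʳ-[] (q -ₚ q′) d₀≢0 [q-q′]d≋[]) ≋-refl ⟩
  [] +ₚ q′        ∎
  where
  open ≋-Reasoning
  split : ∀ q q′ → q ≋ (q -ₚ q′) +ₚ q′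
  split = solve-∀ ℤ[X]-solver-ring
  distrib : ∀ q q′ d → (q -ₚ q′) *ₚ d ≋ q *ₚ d -ₚ q′ *ₚ d
  distrib = solve-∀ ℤ[X]-solver-ring
  qd≋n : q *ₚ d ≋ n
  qd≋n = mk≋ qd≈n
  [q-q′]d≋[] : (q -ₚ q′) *ₚ d ≋ []
  [q-q′]d≋[] = begin
    (q -ₚ q′) *ₚ d    ≈⟨ distrib q q′ d ⟩
    q *ₚ d -ₚ q′ *ₚ d ≈⟨ +ₚ-cong qd≋n (-ₚ-cong q′d≋n) ⟩
    n -ₚ n            ≈⟨ -ₚ-inverseʳ n ⟩
    []                ∎

decomposition : ∀ u x y z A B F₁ G₁ F₂ G₂ S T →
  F₁ *ₚ B ≋ u → G₁ *ₚ A ≋ oneₚ -ₚ x *ₚ y → F₂ *ₚ A ≋ u → G₂ *ₚ B ≋ x *ₚ y *ₚ z -ₚ x *ₚ z →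
  S *ₚ B ≋ oneₚ -ₚ y → T *ₚ A ≋ oneₚ -ₚ z →
  (F₁ *ₚ G₁ +ₚ F₂ *ₚ G₂ +ₚ (-ₚ (x *ₚ (S *ₚ T))) *ₚ u) *ₚ (A *ₚ B) ≋ u *ₚ (oneₚ -ₚ x)
decomposition u x y z A B F₁ G₁ F₂ G₂ S T F₁B G₁A F₂A G₂B SB TA = begin
  (F₁ *ₚ G₁ +ₚ F₂ *ₚ G₂ +ₚ (-ₚ (x *ₚ (S *ₚ T))) *ₚ u) *ₚ (A *ₚ B)
    ≈⟨ regroup F₁ G₁ F₂ G₂ u x S T A B ⟩
  (F₁ *ₚ B) *ₚ (G₁ *ₚ A) +ₚ (F₂ *ₚ A) *ₚ (G₂ *ₚ B) -ₚ u *ₚ (x *ₚ ((S *ₚ B) *ₚ (T *ₚ A)))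
    ≈⟨ +ₚ-cong (+ₚ-cong (*ₚ-cong F₁B G₁A) (*ₚ-cong F₂A G₂B)) (-ₚ-cong (*ₚ-congʳ u (*ₚ-congʳ x (*ₚ-cong SB TA)))) ⟩
  u *ₚ (oneₚ -ₚ x *ₚ y) +ₚ u *ₚ (x *ₚ y *ₚ z -ₚ x *ₚ z) -ₚ u *ₚ (x *ₚ ((oneₚ -ₚ y) *ₚ (oneₚ -ₚ z)))
    ≈⟨ collapse u x y z ⟩
  u *ₚ (oneₚ -ₚ x) ∎
  where
  open ≋-Reasoning
  regroup : ∀ F₁ G₁ F₂ G₂ u x S T A B →
    (F₁ *ₚ G₁ +ₚ F₂ *ₚ G₂ +ₚ (-ₚ (x *ₚ (S *ₚ T))) *ₚ u) *ₚ (A *ₚ B) ≋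
    (F₁ *ₚ B) *ₚ (G₁ *ₚ A) +ₚ (F₂ *ₚ A) *ₚ (G₂ *ₚ B) -ₚ u *ₚ (x *ₚ ((S *ₚ B) *ₚ (T *ₚ A)))
  regroup = solve-∀ ℤ[X]-solver-ring
  collapse : ∀ u x y z →
    u *ₚ (oneₚ -ₚ x *ₚ y) +ₚ u *ₚ (x *ₚ y *ₚ z -ₚ x *ₚ z) -ₚ u *ₚ (x *ₚ ((oneₚ -ₚ y) *ₚ (oneₚ -ₚ z)))
      ≋ u *ₚ (oneₚ -ₚ x)
  collapse = solve-∀ ℤ[X]-solver-ring

module ExplicitQuotients
  {p q a b : ℕ} .{{p≢0 : NonZero p}} .{{q≢0 : NonZero q}} (e : InverseExponents p q a b) where
  open InverseExponents e
  open ≋-Reasoning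

  u A B x y z F₁ G₁ F₂ G₂ correction P₀ : Poly
  u = oneₚ -ₚ X^ (p * q)
  A = oneₚ -ₚ X^ p
  B = oneₚ -ₚ X^ q
  x = X^ 1
  y = X^ (q * s)
  z = X^ (p * t)
  F₁ = geometric q p
  G₁ = geometric p a
  F₂ = geometric p q
  G₂ = -ₚ (X^ (q * b) *ₚ geometric q (p ∸ b))
  correction = -ₚ (x *ₚ (geometric q s *ₚ geometric p t))
  P₀ = F₁ *ₚ G₁ +ₚ F₂ *ₚ G₂ +ₚ correction *ₚ u

  F₁-quotient : F₁ *ₚ B ≋ u
  F₁-quotient = ≋-trans (geometric-quotient q p) (≋-reflexive (cong (λ k → oneₚ -ₚ X^ k) (*-comm q p)))

  G₁-quotient : G₁ *ₚ A ≋ oneₚ -ₚ X^ (p * a)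
  G₁-quotient = geometric-quotient p a

  F₂-quotient : F₂ *ₚ A ≋ u
  F₂-quotient = geometric-quotient p q

  G₂-quotient : G₂ *ₚ B ≋ X^ (p * q) -ₚ X^ (q * b)
  G₂-quotient = ≋-trans (shifted-geometric-quotient (q * b) q (p ∸ b))
    (≋-reflexive (cong (λ k → X^ k -ₚ X^ (q * b)) qb+q[p∸b]≡pq))
    where
    qb+q[p∸b]≡pq : q * b + q * (p ∸ b) ≡ p * q
    qb+q[p∸b]≡pq = trans (sym (*-distribˡ-+ q b (p ∸ b))) (trans (cong (q *_) (m+[n∸m]≡n b≤p)) (*-comm q p))

  X^pa≋xy : X^ (p * a) ≋ x *ₚ y
  X^pa≋xy = ≋-trans (≋-reflexive (cong X^ pa≡1+qs)) (≋-sym (X^-+ 1 (q * s)))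

  X^qb≋xz : X^ (q * b) ≋ x *ₚ z
  X^qb≋xz = ≋-trans (≋-reflexive (cong X^ qb≡1+pt)) (≋-sym (X^-+ 1 (p * t)))

  X^pq≋xyz : X^ (p * q) ≋ x *ₚ y *ₚ z
  X^pq≋xyz = begin
    X^ (p * q)                 ≈⟨ ≋-reflexive (cong X^ pq≡1+qs+pt) ⟩
    X^ (1 + (q * s + p * t))   ≈⟨ X^-+ 1 (q * s + p * t) ⟨
    x *ₚ X^ (q * s + p * t)    ≈⟨ *ₚ-congʳ x (X^-+ (q * s) (p * t)) ⟨
    x *ₚ (y *ₚ z)              ≈⟨ *ₚ-assoc x y z ⟨
    x *ₚ y *ₚ z                ∎

  P₀-quotient : P₀ *ₚ (A *ₚ B) ≋ u *ₚ (oneₚ -ₚ X^ 1)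
  P₀-quotient = decomposition u x y z A B F₁ G₁ F₂ G₂ (geometric q s) (geometric p t)
    F₁-quotient (≋-trans G₁-quotient (+ₚ-cong ≋-refl (-ₚ-cong X^pa≋xy)))
    F₂-quotient (≋-trans G₂-quotient (+ₚ-cong X^pq≋xyz (-ₚ-cong X^qb≋xz)))
    (geometric-quotient q s) (geometric-quotient p t)

  congruence : (P F₁′ G₁′ F₂′ G₂′ : Poly) →
    IsQuot P (u *ₚ (oneₚ -ₚ X^ 1)) (A *ₚ B) →
    IsQuot F₁′ u B →
    IsQuot G₁′ (oneₚ -ₚ X^ (p * a)) A →
    IsQuot F₂′ u A →
    IsQuot G₂′ (X^ (p * q) -ₚ X^ (q * b)) B →
    CongMod P (F₁′ *ₚ G₁′ +ₚ F₂′ *ₚ G₂′) u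
  congruence P F₁′ G₁′ F₂′ G₂′ P-quot F₁′-quot G₁′-quot F₂′-quot G₂′-quot = correction , coeff-≡ (begin
    P -ₚ (F₁′ *ₚ G₁′ +ₚ F₂′ *ₚ G₂′)
      ≈⟨ +ₚ-cong (quotient-unique P P₀ AB₀≢0 P-quot P₀-quotient) (-ₚ-cong (+ₚ-cong
           (*ₚ-cong (quotient-unique F₁′ F₁ B₀≢0 F₁′-quot F₁-quotient) (quotient-unique G₁′ G₁ A₀≢0 G₁′-quot G₁-quotient))
           (*ₚ-cong (quotient-unique F₂′ F₂ A₀≢0 F₂′-quot F₂-quotient) (quotient-unique G₂′ G₂ B₀≢0 G₂′-quot G₂-quotient)))) ⟩
    P₀ -ₚ (F₁ *ₚ G₁ +ₚ F₂ *ₚ G₂)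
      ≈⟨ [f+h]-f≋h (F₁ *ₚ G₁ +ₚ F₂ *ₚ G₂) (correction *ₚ u) ⟩
    correction *ₚ u ∎)
    where
    [f+h]-f≋h : ∀ f h → (f +ₚ h) -ₚ f ≋ h
    [f+h]-f≋h = solve-∀ ℤ[X]-solver-ring
    ≡1ℤ⇒≢0ℤ : ∀ {c} → c ≡ 1ℤ → c ≢ 0ℤ
    ≡1ℤ⇒≢0ℤ refl ()
    A₀≢0 : coeff A 0 ≢ 0ℤ
    A₀≢0 = ≡1ℤ⇒≢0ℤ (coeff-1-X^-0 p)
    B₀≢0 : coeff B 0 ≢ 0ℤ
    B₀≢0 = ≡1ℤ⇒≢0ℤ (coeff-1-X^-0 q)
    AB₀≢0 : coeff (A *ₚ B) 0 ≢ 0ℤ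
    AB₀≢0 = ≡1ℤ⇒≢0ℤ (trans (coeff-*ₚ-0 A B)
                             (cong₂ ℤ._*_ (coeff-1-X^-0 p) (coeff-1-X^-0 q)))

mainTheorem5 : (p q : ℕ) → Prime p → Prime q → p ≢ q →
  (a b : ℕ) → Bracket q 1 p a → Bracket p 1 q b →
  -- existence of the quotients (P_pq and the four factors on the right are polynomials)
  (Σ Poly λ P → Σ Poly λ F₁ → Σ Poly λ G₁ → Σ Poly λ F₂ → Σ Poly λ G₂ →
    IsQuot P ((oneₚ -ₚ X^ (p * q)) *ₚ (oneₚ -ₚ X^ 1)) ((oneₚ -ₚ X^ p) *ₚ (oneₚ -ₚ X^ q)) ×
    IsQuot F₁ (oneₚ -ₚ X^ (p * q)) (oneₚ -ₚ X^ q) ×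
    IsQuot G₁ (oneₚ -ₚ X^ (p * a)) (oneₚ -ₚ X^ p) ×
    IsQuot F₂ (oneₚ -ₚ X^ (p * q)) (oneₚ -ₚ X^ p) ×
    IsQuot G₂ (X^ (p * q) -ₚ X^ (q * b)) (oneₚ -ₚ X^ q)) ×
  -- the congruence modulo 1 - x^{pq}
  ((P F₁ G₁ F₂ G₂ : Poly) →
    IsQuot P ((oneₚ -ₚ X^ (p * q)) *ₚ (oneₚ -ₚ X^ 1)) ((oneₚ -ₚ X^ p) *ₚ (oneₚ -ₚ X^ q)) →
    IsQuot F₁ (oneₚ -ₚ X^ (p * q)) (oneₚ -ₚ X^ q) →
    IsQuot G₁ (oneₚ -ₚ X^ (p * a)) (oneₚ -ₚ X^ p) →
    IsQuot F₂ (oneₚ -ₚ X^ (p * q)) (oneₚ -ₚ X^ p) →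
    IsQuot G₂ (X^ (p * q) -ₚ X^ (q * b)) (oneₚ -ₚ X^ q) →
    CongMod P (F₁ *ₚ G₁ +ₚ F₂ *ₚ G₂) (oneₚ -ₚ X^ (p * q)))
mainTheorem5 p q p-prime q-prime p≢q a b a-inv b-inv =
  ( P₀ , F₁ , G₁ , F₂ , G₂
  , coeff-≡ P₀-quotient , coeff-≡ F₁-quotient , coeff-≡ G₁-quotient , coeff-≡ F₂-quotient , coeff-≡ G₂-quotient)
  , congruence
  where
  open ExplicitQuotients {{prime⇒nonZero p-prime}} {{prime⇒nonZero q-prime}}
    (inverse-exponents p-prime q-prime p≢q a-inv b-inv)
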